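{- Let $\mathbf{F}$ be a field, $S_1,\ldots,S_m,S'\subseteq\mathbf{F}$ finite sets with $|S_j|=s_j$ and $|S'|=s'$, $r$ a positive integer and $i_1,\ldots,i_m$ non-negative integers. If $H(i_1,\ldots,i_m,r,s_1,\ldots,s_m)=D(i_1,\ldots,i_m,r,s_1,\ldots,s_m)$, then for any $t\in\{0,\ldots,m\}$, $$H(i_1,\ldots,i_t,0,i_{t+1},\ldots,i_m,r,s_1,\ldots,s_t,s',s_{t+1},\ldots,s_m)=D(i_1,\ldots,i_t,0,i_{t+1},\ldots,i_m,r,s_1,\ldots,s_t,s',s_{t+1},\ldots,s_m)=s'\,D(i_1,\ldots,i_m,r,s_1,\ldots,s_m),$$ where the $(m+1)$-variable quantity $H$ is taken with respect to the sets $S_1,\ldots,S_t,S',S_{t+1},\ldots,S_m$.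
   Context: $D$: $D(i_1,r,s_1)=\min\{\lfloor i_1/r\rfloor,s_1\}$, and for $n\ge2$, $D(i_1,\ldots,i_n,r,s_1,\ldots,s_n)$ is the maximum over $(u_1,\ldots,u_r)\in\mathbf{N}_0^r$ with $u_1+\cdots+u_r\le s_n$ and $u_1+2u_2+\cdots+ru_r\le i_n$ of $(s_n-u_1-\cdots-u_r)D(i_1,\ldots,i_{n-1},r,s_1,\ldots,s_{n-1})+\sum_{j=1}^{r-1}u_jD(i_1,\ldots,i_{n-1},r-j,s_1,\ldots,s_{n-1})+u_rs_1\cdots s_{n-1}$. $H$: for finite sets $T_1,\ldots,T_n\subseteq\mathbf{F}$ with $|T_j|=s_j$, $H(i_1,\ldots,i_n,r,s_1,\ldots,s_n)$ is the maximum, over all polynomials $F\in\mathbf{F}[X_1,\ldots,X_n]$ that are products of univariate linear factors $X_u-\beta$ ($\beta\in\mathbf{F}$) and have leading monomial $X_1^{i_1}\cdots X_n^{i_n}$ (lexicographic order with $X_n\prec\cdots\prec X_1$), of the number of points $\vec a\in T_1\times\cdots\times T_n$ with $\mathrm{mult}(F,\vec a)\ge r$. Here $\mathrm{mult}(F,\vec a)$ is the integer $M$ such that all Hasse derivatives $F^{(\vec k)}$ (coefficients of $\vec Z^{\vec k}$ in $F(\vec X+\vec Z)$) with $k_1+\cdots+k_n<M$ vanish at $\vec a$ and some with $k_1+\cdots+k_n=M$ does not. -}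

module Defs where

open import Level using (Level; _⊔_) renaming (suc to lsuc)
open import Algebra.Bundles using (CommutativeRing)
open import Data.Nat using (ℕ; zero; suc)
open import Data.Nat as N using ()
open import Data.Nat.Combinatorics using (_C_)
open import Data.Bool using (if_then_else_; _∧_)
open import Data.Fin using (Fin; toℕ; inject₁; fromℕ)
open import Data.Product using (_×_; _,_; ∃; Σ)
open import Data.List as L using (List; []; _∷_; concatMap; upTo; allFin; length)
open import Data.List.Relation.Unary.All using (All)
open import Data.List.Relation.Unary.Any using (Any)
open import Data.List.Relation.Unary.AllPairs using (AllPairs)
open import Data.Vec as V using (Vec; []; _∷_; lookup; replicate; updateAt; tabulate; reverse; toList; last)
open import Relation.Nullary using (¬_)
open import Relation.Binary.PropositionalEquality using (_≡_)

record Field (c ℓ : Level) : Set (lsuc (c ⊔ ℓ)) where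
  field
    commutativeRing : CommutativeRing c ℓ
  open CommutativeRing commutativeRing public
  field
    1≉0     : ¬ (1# ≈ 0#)
    inverse : ∀ x → ¬ (x ≈ 0#) → ∃ λ y → x * y ≈ 1#

module DPart where
  open N using (_+_; _*_; _∸_; _⊓_; _≤ᵇ_; _/_)

  -- floor division, with the (never used) convention i / 0 = 0
  fdiv : ℕ → ℕ → ℕ
  fdiv i zero    = 0
  fdiv i (suc k) = i / suc k

  maxList : List ℕ → ℕ
  maxList = L.foldr N._⊔_ 0

  -- all vectors (u_1,…,u_r) with every entry ≤ s (a finite superset of the
  -- feasible region, since u_1+⋯+u_r ≤ s forces each u_j ≤ s)
  boundedVecs : ∀ r → ℕ → List (Vec ℕ r)
  boundedVecs zero    s = [] ∷ []
  boundedVecs (suc r) s = concatMap (λ x → L.map (x ∷_) (boundedVecs r s)) (upTo (suc s))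

  sumFin : ∀ k → (Fin k → ℕ) → ℕ
  sumFin k f = V.sum (tabulate f)

  -- Drev n is r ss : D with the variables listed in REVERSE order, i.e. the
  -- head of `is`/`ss` is (i_n, s_n) and the tail is (i_{n-1},…,i_1).
  -- r = 0 never occurs for the statement (r ≥ 1 and r-j ≥ 1 in the recursion);
  -- we set it to 0 by convention.
  Drev : ∀ n → Vec ℕ (suc n) → ℕ → Vec ℕ (suc n) → ℕ
  Drev n       is         zero    ss         = 0
  Drev zero    (i ∷ [])   (suc r) (s ∷ [])   = fdiv i (suc r) ⊓ s
  Drev (suc n) (i ∷ is)   (suc r) (s ∷ ss)   = maxList (L.map value (boundedVecs (suc r) s))
    where
    -- u_j is  lookup u (j-1)
    value : Vec ℕ (suc r) → ℕ
    value u =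
      if (V.sum u ≤ᵇ s) ∧ (sumFin (suc r) (λ k → suc (toℕ k) * lookup u k) ≤ᵇ i)
      then (s ∸ V.sum u) * Drev n is (suc r) ss
           + sumFin r (λ k → lookup u (inject₁ k) * Drev n is (suc r ∸ suc (toℕ k)) ss)
           + last u * V.foldr _ _*_ 1 ss
      else 0

  D : ∀ {n} → Vec ℕ (suc n) → ℕ → Vec ℕ (suc n) → ℕ
  D {n} i r s = Drev n (reverse i) r (reverse s)


open DPart public

module _ {c ℓ : Level} (F : Field c ℓ) where
  open Field F

  nmul : ℕ → Carrier → Carrier
  nmul zero    x = 0#
  nmul (suc k) x = x + nmul k x

  pow : Carrier → ℕ → Carrier
  pow x zero    = 1#
  pow x (suc k) = x * pow x k

  -- a term  c · X^e
  Term : ℕ → Set c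
  Term n = Carrier × Vec ℕ n

  -- A product of linear factors X_u - β with exactly i_u factors in the
  -- variable X_u; the roots of the factors in variable u are `roots u`.
  Roots : ∀ n → Vec ℕ n → Set c
  Roots n i = (u : Fin n) → Vec Carrier (lookup i u)

  factors : ∀ {n} (i : Vec ℕ n) → Roots n i → List (Fin n × Carrier)
  factors {n} i roots = concatMap (λ u → L.map (u ,_) (toList (roots u))) (allFin n)

  mulLin : ∀ {n} → Fin n × Carrier → List (Term n) → List (Term n)
  mulLin (u , β) = concatMap (λ { (a , e) → (a , updateAt e u suc) ∷ (- (β * a) , e) ∷ [] })

  -- the expanded polynomial (as a list of terms; like terms not collected)
  expand : ∀ {n} (i : Vec ℕ n) → Roots n i → List (Term n)
  expand {n} i roots = L.foldr mulLin ((1# , replicate n 0) ∷ []) (factors i roots)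

  hasseMono : ∀ {n} → Vec ℕ n → Vec ℕ n → Vec Carrier n → Carrier
  hasseMono []       []       []       = 1#
  hasseMono (e ∷ es) (k ∷ ks) (a ∷ as) = nmul (e C k) (pow a (e N.∸ k)) * hasseMono es ks as

  -- P^(k)(a): the coefficient of Z^k in P(X+Z), evaluated at X = a
  hasseAt : ∀ {n} → List (Term n) → Vec ℕ n → Vec Carrier n → Carrier
  hasseAt ts k a = L.foldr (λ { (b , e) acc → b * hasseMono e k a + acc }) 0# ts

  MultAtLeast : ∀ {n} → List (Term n) → ℕ → Vec Carrier n → Set ℓ
  MultAtLeast P r a = ∀ k → V.sum k N.< r → hasseAt P k a ≈ 0#

  -- a finite set: a list of pairwise distinct elements (its size is the length)
  IsFinSet : List Carrier → Set (c ⊔ ℓ)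
  IsFinSet S = AllPairs (λ x y → ¬ (x ≈ y)) S

  InBox : ∀ {n} → Vec (List Carrier) n → Vec Carrier n → Set (c ⊔ ℓ)
  InBox Ts a = ∀ j → Any (λ y → lookup a j ≈ y) (lookup Ts j)

  DistinctPt : ∀ {n} → Vec Carrier n → Vec Carrier n → Set ℓ
  DistinctPt a b = ¬ (∀ j → lookup a j ≈ lookup b j)

  AtLeastPoints : ∀ {n} → Vec (List Carrier) n → List (Term n) → ℕ → ℕ → Set (c ⊔ ℓ)
  AtLeastPoints Ts P r h =
    Σ (List (Vec Carrier _)) λ pts →
      (length pts ≡ h) × All (λ a → InBox Ts a × MultAtLeast P r a) pts × AllPairs DistinctPt pts

  -- H(i, r, |T_1|,…,|T_n|) (w.r.t. the sets Ts) equals v: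
  -- v is attained by some admissible polynomial and no admissible polynomial
  -- has more than v points of multiplicity ≥ r in the grid.
  IsH : ∀ {n} → Vec (List Carrier) n → Vec ℕ n → ℕ → ℕ → Set (c ⊔ ℓ)
  IsH {n} Ts i r v =
    (Σ (Roots n i) λ roots → AtLeastPoints Ts (expand i roots) r v)
    × (∀ (roots : Roots n i) h → AtLeastPoints Ts (expand i roots) r h → h N.≤ v)

{-# OPTIONS --safe #-}
-- A new variable in which F has degree 0 only enlarges the grid. Hasse
-- derivatives of positive order in that variable vanish identically, and the
-- others do not see its coordinate, so the points of multiplicity ≥ r in the
-- enlarged grid are exactly the pairs (a, y) with a such a point of the old
-- grid and y ∈ S'; hence H is multiplied by |S'|. On the side of D, at the new
-- variable (i = 0) the only feasible u is 0, which contributes s' times the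
-- remaining D, and at every other variable each candidate value is scaled by
-- s'; so D is multiplied by s' as well.
module Submission where

open import Defs
import Level
open import Function using (_∘_)
open import Data.Bool using (true; false; if_then_else_; _∧_; T)
open import Data.Unit using (tt)
open import Data.Nat using (ℕ; zero; suc; _+_; _*_; _∸_; _⊔_; _⊓_; _/_; _≤_; _<_; _≤ᵇ_; z≤n; s≤s)
open import Data.Nat.Properties
open import Data.Nat.DivMod using (m*n/n≡m; /-monoˡ-≤; m/n*n≤m)
open import Data.Nat.Tactic.RingSolver using (solve-∀)
open import Data.Fin using (Fin; zero; suc; toℕ; inject₁; fromℕ; opposite; punchIn)
open import Data.Vec as V using (Vec; []; _∷_; lookup; insertAt; removeAt; map; last; reverse; toList)
open import Data.Vec.Properties using (map-insertAt; tabulate-cong; lookup-replicate; reverse-∷; insertAt-removeAt)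
open import Data.List as L using (List; []; _∷_; length; allFin)
open import Data.List.Properties using (length-map; length-++; map-tabulate; concat-map; map-∘; map-cong) renaming (tabulate-cong to L-tabulate-cong)
open import Data.List.Membership.Propositional using (_∈_)
open import Data.List.Membership.Propositional.Properties using (∈-map⁺; ∈-concat⁺′; ∈-upTo⁺)
open import Data.List.Relation.Unary.Any using (Any; here; there)
open import Data.List.Relation.Unary.All as All using (All; []; _∷_)
import Data.List.Relation.Unary.All.Properties as All
open import Data.List.Relation.Unary.AllPairs as AllPairs using (AllPairs; []; _∷_)
import Data.List.Relation.Unary.AllPairs.Properties as AllPairs
open import Data.List.Relation.Binary.Sublist.Propositional using (_⊆_; []; _∷_; _∷ʳ_)
open import Data.List.Relation.Binary.Sublist.Propositional.Properties using (All-resp-⊆)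
open import Data.Product using (Σ; ∃; _×_; _,_; proj₁; proj₂)
open import Data.Sum using (_⊎_; inj₁; inj₂)
open import Relation.Nullary using (¬_)
open import Relation.Binary.PropositionalEquality

maxList-lub : ∀ {A : Set} (f : A → ℕ) xs {v} → (∀ x → f x ≤ v) → maxList (L.map f xs) ≤ v
maxList-lub f []       f≤v = z≤n
maxList-lub f (x ∷ xs) f≤v = ⊔-lub (f≤v x) (maxList-lub f xs f≤v)

maxList-ub : ∀ {A : Set} (f : A → ℕ) {xs x} → x ∈ xs → f x ≤ maxList (L.map f xs)
maxList-ub f (here refl)        = m≤m⊔n _ _
maxList-ub f {y ∷ _} (there x∈) = ≤-trans (maxList-ub f x∈) (m≤n⊔m (f y) _)

maxList-attained : ∀ {A : Set} (f : A → ℕ) xs {v x} →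
  (∀ x → f x ≤ v) → x ∈ xs → f x ≡ v → maxList (L.map f xs) ≡ v
maxList-attained f xs f≤v x∈ refl = ≤-antisym (maxList-lub f xs f≤v) (maxList-ub f x∈)

maxList-scale : ∀ {A : Set} (f g : A → ℕ) c xs →
  (∀ x → f x ≡ c * g x) → maxList (L.map f xs) ≡ c * maxList (L.map g xs)
maxList-scale f g c []       f≡cg = sym (*-zeroʳ c)
maxList-scale f g c (x ∷ xs) f≡cg =
  trans (cong₂ _⊔_ (f≡cg x) (maxList-scale f g c xs f≡cg)) (sym (*-distribˡ-⊔ c (g x) _))

sumFin-cong : ∀ r {f g : Fin r → ℕ} → (∀ k → f k ≡ g k) → sumFin r f ≡ sumFin r g
sumFin-cong r f≡g = cong V.sum (tabulate-cong f≡g)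

sumFin-+ : ∀ r (f g : Fin r → ℕ) → sumFin r (λ k → f k + g k) ≡ sumFin r f + sumFin r g
sumFin-+ zero    f g = refl
sumFin-+ (suc r) f g =
  trans (cong (f zero + g zero +_) (sumFin-+ r (λ k → f (suc k)) (λ k → g (suc k))))
        (interchange (f zero) (g zero) _ _)
  where
  interchange : ∀ a b c d → a + b + (c + d) ≡ a + c + (b + d)
  interchange = solve-∀

sumFin-*ˡ : ∀ r c (f : Fin r → ℕ) → sumFin r (λ k → c * f k) ≡ c * sumFin r f
sumFin-*ˡ zero    c f = sym (*-zeroʳ c)
sumFin-*ˡ (suc r) c f =
  trans (cong (c * f zero +_) (sumFin-*ˡ r c (λ k → f (suc k)))) (sym (*-distribˡ-+ c (f zero) _))

sumFin-zero : ∀ r {f : Fin r → ℕ} → (∀ k → f k ≡ 0) → sumFin r f ≡ 0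
sumFin-zero zero    f≡0 = refl
sumFin-zero (suc r) f≡0 = cong₂ _+_ (f≡0 zero) (sumFin-zero r (λ k → f≡0 (suc k)))

sumFin-lookup : ∀ r (u : Vec ℕ r) → sumFin r (lookup u) ≡ V.sum u
sumFin-lookup zero    []      = refl
sumFin-lookup (suc r) (x ∷ u) = cong (x +_) (sumFin-lookup r u)

sum-insertAt : ∀ {n} (k : Vec ℕ n) t x → V.sum (insertAt k t x) ≡ x + V.sum k
sum-insertAt k       zero    x = refl
sum-insertAt (y ∷ k) (suc t) x = trans (cong (y +_) (sum-insertAt k t x)) (+-left-comm y x _)
  where
  +-left-comm : ∀ a b c → a + (b + c) ≡ b + (a + c)
  +-left-comm = solve-∀

product-insertAt : ∀ {n} (ss : Vec ℕ n) t s → V.foldr _ _*_ 1 (insertAt ss t s) ≡ s * V.foldr _ _*_ 1 ss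
product-insertAt ss       zero    s = refl
product-insertAt (x ∷ ss) (suc t) s = trans (cong (x *_) (product-insertAt ss t s)) (*-left-comm x s _)
  where
  *-left-comm : ∀ a b c → a * (b * c) ≡ b * (a * c)
  *-left-comm = solve-∀

sum≡0⇒replicate : ∀ r (u : Vec ℕ r) → V.sum u ≡ 0 → u ≡ V.replicate r 0
sum≡0⇒replicate zero    []      _   = refl
sum≡0⇒replicate (suc r) (x ∷ u) Σ≡0 =
  cong₂ _∷_ (m+n≡0⇒m≡0 x Σ≡0) (sum≡0⇒replicate r u (m+n≡0⇒n≡0 x Σ≡0))

sum-replicate-zero : ∀ r → V.sum (V.replicate r 0) ≡ 0
sum-replicate-zero zero    = refl
sum-replicate-zero (suc r) = sum-replicate-zero r

last-replicate : ∀ {A : Set} r (x : A) → last (V.replicate (suc r) x) ≡ x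
last-replicate zero    x = refl
last-replicate (suc r) x = last-replicate r x

last≤sum : ∀ r (u : Vec ℕ (suc r)) → last u ≤ V.sum u
last≤sum zero    (x ∷ [])     = m≤m+n x 0
last≤sum (suc r) (x ∷ y ∷ ys) = ≤-trans (last≤sum r (y ∷ ys)) (m≤n+m _ x)

insertAt-replicate : ∀ {A : Set} {n} (x : A) t → insertAt (V.replicate n x) t x ≡ V.replicate (suc n) x
insertAt-replicate         x zero    = refl
insertAt-replicate {n = suc n} x (suc t) = cong (x ∷_) (insertAt-replicate x t)

insertAt-∷ʳ : ∀ {A : Set} {n} (xs : Vec A n) t x y → insertAt xs t x V.∷ʳ y ≡ insertAt (xs V.∷ʳ y) (inject₁ t) x
insertAt-∷ʳ xs       zero    x y = refl
insertAt-∷ʳ (z ∷ xs) (suc t) x y = cong (z ∷_) (insertAt-∷ʳ xs t x y)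

∷ʳ≡insertAt-fromℕ : ∀ {A : Set} {n} (xs : Vec A n) x → xs V.∷ʳ x ≡ insertAt xs (fromℕ n) x
∷ʳ≡insertAt-fromℕ []       x = refl
∷ʳ≡insertAt-fromℕ (y ∷ xs) x = cong (y ∷_) (∷ʳ≡insertAt-fromℕ xs x)

reverse-insertAt : ∀ {A : Set} {n} (xs : Vec A n) t x → reverse (insertAt xs t x) ≡ insertAt (reverse xs) (opposite t) x
reverse-insertAt xs zero x = trans (reverse-∷ x xs) (∷ʳ≡insertAt-fromℕ (reverse xs) x)
reverse-insertAt (y ∷ xs) (suc t) x = begin
  reverse (y ∷ insertAt xs t x)                         ≡⟨ reverse-∷ y (insertAt xs t x) ⟩
  reverse (insertAt xs t x) V.∷ʳ y                      ≡⟨ cong (V._∷ʳ y) (reverse-insertAt xs t x) ⟩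
  insertAt (reverse xs) (opposite t) x V.∷ʳ y           ≡⟨ insertAt-∷ʳ (reverse xs) (opposite t) x y ⟩
  insertAt (reverse xs V.∷ʳ y) (inject₁ (opposite t)) x ≡⟨ cong (λ z → insertAt z (inject₁ (opposite t)) x) (reverse-∷ y xs) ⟨
  insertAt (reverse (y ∷ xs)) (opposite (suc t)) x      ∎
  where open ≡-Reasoning

updateAt-insertAt-punchIn : ∀ {a} {A : Set a} {n} (e : Vec A n) t x u (f : A → A) →
  V.updateAt (insertAt e t x) (punchIn t u) f ≡ insertAt (V.updateAt e u f) t x
updateAt-insertAt-punchIn e       zero    x u       f = refl
updateAt-insertAt-punchIn (y ∷ e) (suc t) x zero    f = refl
updateAt-insertAt-punchIn (y ∷ e) (suc t) x (suc u) f = cong (y ∷_) (updateAt-insertAt-punchIn e t x u f)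

module _ {a b q} {A : Set a} {B : Set b} (Q : A → B → Set q) where

  Pointwise : ∀ {n} → Vec A n → Vec B n → Set q
  Pointwise xs ys = ∀ j → Q (lookup xs j) (lookup ys j)

  Pointwise-insertAt⁺ : ∀ {n} {xs : Vec A n} {ys} t {x y} →
    Q x y → Pointwise xs ys → Pointwise (insertAt xs t x) (insertAt ys t y)
  Pointwise-insertAt⁺ zero q xs~ys zero    = q
  Pointwise-insertAt⁺ zero q xs~ys (suc j) = xs~ys j
  Pointwise-insertAt⁺ {xs = _ ∷ _} {_ ∷ _} (suc t) q xs~ys zero    = xs~ys zero
  Pointwise-insertAt⁺ {xs = _ ∷ _} {_ ∷ _} (suc t) q xs~ys (suc j) =
    Pointwise-insertAt⁺ t q (λ j → xs~ys (suc j)) j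

  Pointwise-insertAt⁻ : ∀ {n} {xs : Vec A n} {ys} t {x y} →
    Pointwise (insertAt xs t x) (insertAt ys t y) → Q x y × Pointwise xs ys
  Pointwise-insertAt⁻ zero ~ = ~ zero , λ j → ~ (suc j)
  Pointwise-insertAt⁻ {xs = _ ∷ _} {_ ∷ _} (suc t) ~ with Pointwise-insertAt⁻ t (λ j → ~ (suc j))
  ... | q , xs~ys = q , λ { zero → ~ zero ; (suc j) → xs~ys j }

AllPairs-resp-⊆ : ∀ {a r} {A : Set a} {R : A → A → Set r} {xs ys : List A} → xs ⊆ ys → AllPairs R ys → AllPairs R xs
AllPairs-resp-⊆ []            []         = []
AllPairs-resp-⊆ (y ∷ʳ xs⊆ys)  (_ ∷ Rys)  = AllPairs-resp-⊆ xs⊆ys Rys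
AllPairs-resp-⊆ (refl ∷ xs⊆ys) (Ry ∷ Rys) = All-resp-⊆ xs⊆ys Ry ∷ AllPairs-resp-⊆ xs⊆ys Rys

AllPairs-map⁺-within : ∀ {a b p r s} {A : Set a} {B : Set b} {P : A → Set p} {R : A → A → Set r} {S : B → B → Set s}
  (f : A → B) → (∀ {x y} → P x → P y → R x y → S (f x) (f y)) →
  ∀ {xs} → All P xs → AllPairs R xs → AllPairs S (L.map f xs)
AllPairs-map⁺-within f R⇒S []         []         = []
AllPairs-map⁺-within {P = P} {R} {S} f R⇒S {x ∷ xs} (px ∷ pxs) (Rx ∷ Rxs) =
  All.map⁺ (related pxs Rx) ∷ AllPairs-map⁺-within f R⇒S pxs Rxs
  where
  related : ∀ {ys} → All P ys → All (R x) ys → All (λ y → S (f x) (f y)) ys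
  related []         []         = []
  related (py ∷ pys) (Rxy ∷ Rxys) = R⇒S px py Rxy ∷ related pys Rxys

partition-⊎ : ∀ {a p q} {A : Set a} {P : A → Set p} {Q : A → Set q} {xs : List A} → All (λ x → P x ⊎ Q x) xs →
  ∃ λ ys → ∃ λ zs → ys ⊆ xs × zs ⊆ xs × All P ys × All Q zs × length ys + length zs ≡ length xs
partition-⊎ [] = [] , [] , [] , [] , [] , [] , refl
partition-⊎ {xs = x ∷ xs} (inj₁ px ∷ pqs) with partition-⊎ pqs
... | ys , zs , ys⊆ , zs⊆ , Pys , Qzs , len = x ∷ ys , zs , refl ∷ ys⊆ , x ∷ʳ zs⊆ , px ∷ Pys , Qzs , cong suc len
partition-⊎ {xs = x ∷ xs} (inj₂ qx ∷ pqs) with partition-⊎ pqs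
... | ys , zs , ys⊆ , zs⊆ , Pys , Qzs , len =
  ys , x ∷ zs , x ∷ʳ ys⊆ , refl ∷ zs⊆ , Pys , qx ∷ Qzs , trans (+-suc _ _) (cong suc len)

length-concatMap-const : ∀ {a b} {A : Set a} {B : Set b} (f : A → List B) {k} xs →
  (∀ x → length (f x) ≡ k) → length (L.concatMap f xs) ≡ length xs * k
length-concatMap-const f []       len≡k = refl
length-concatMap-const f (x ∷ xs) len≡k =
  trans (length-++ (f x)) (cong₂ _+_ (len≡k x) (length-concatMap-const f xs len≡k))

concat-tabulate-punchIn : ∀ {b} {B : Set b} {n} (g : Fin (suc n) → List B) t → g t ≡ [] →
  L.concat (L.tabulate g) ≡ L.concat (L.tabulate (λ j → g (punchIn t j)))
concat-tabulate-punchIn g zero gt≡[] = cong (L._++ L.concat (L.tabulate (λ j → g (suc j)))) gt≡[]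
concat-tabulate-punchIn {n = suc n} g (suc t) gt≡[] =
  cong (g zero L.++_) (concat-tabulate-punchIn (λ j → g (suc j)) t gt≡[])

if∧-≤ : ∀ b₁ b₂ {x v} → (T b₁ → T b₂ → x ≤ v) → (if b₁ ∧ b₂ then x else 0) ≤ v
if∧-≤ true  true  x≤v = x≤v tt tt
if∧-≤ true  false x≤v = z≤n
if∧-≤ false b₂    x≤v = z≤n

if∧-true : ∀ {b₁ b₂} (x : ℕ) → T b₁ → T b₂ → (if b₁ ∧ b₂ then x else 0) ≡ x
if∧-true {true} {true} x _ _ = refl

if-*ˡ : ∀ b {x y} c → x ≡ c * y → (if b then x else 0) ≡ c * (if b then y else 0)
if-*ˡ true  c x≡cy = x≡cy
if-*ˡ false c x≡cy = sym (*-zeroʳ c)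

weight : ∀ r → Vec ℕ r → ℕ
weight r u = sumFin r (λ k → suc (toℕ k) * lookup u k)

weight-∷ : ∀ r x (u : Vec ℕ r) → weight (suc r) (x ∷ u) ≡ x + (V.sum u + weight r u)
weight-∷ r x u = cong₂ _+_ (+-identityʳ x)
  (trans (sumFin-+ r (lookup u) (λ k → suc (toℕ k) * lookup u k)) (cong (_+ weight r u) (sumFin-lookup r u)))

sum≤weight : ∀ r (u : Vec ℕ (suc r)) → V.sum u ≤ weight (suc r) u
sum≤weight r (x ∷ u) rewrite weight-∷ r x u = +-monoʳ-≤ x (m≤m+n (V.sum u) _)

*-last≤weight : ∀ r (u : Vec ℕ (suc r)) → suc r * last u ≤ weight (suc r) u
*-last≤weight zero    (x ∷ [])     = m≤m+n (1 * x) 0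
*-last≤weight (suc r) (x ∷ y ∷ ys) rewrite weight-∷ (suc r) x (y ∷ ys) =
  ≤-trans (+-mono-≤ (last≤sum r (y ∷ ys)) (*-last≤weight r (y ∷ ys))) (m≤n+m _ x)

weight-replicate-zero : ∀ r → weight r (V.replicate r 0) ≡ 0
weight-replicate-zero r = sumFin-zero r (λ k → trans (cong (suc (toℕ k) *_) (lookup-replicate k 0)) (*-zeroʳ (suc (toℕ k))))

boundedVecs-complete : ∀ r s (u : Vec ℕ r) → (∀ k → lookup u k ≤ s) → u ∈ boundedVecs r s
boundedVecs-complete zero    s []      u≤s = here refl
boundedVecs-complete (suc r) s (x ∷ u) u≤s =
  ∈-concat⁺′ (∈-map⁺ (x ∷_) (boundedVecs-complete r s u (λ k → u≤s (suc k))))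
             (∈-map⁺ (λ y → L.map (y ∷_) (boundedVecs r s)) (∈-upTo⁺ (s≤s (u≤s zero))))

-- Copies of the local `value` of the recursive clause of Drev, so that this
-- clause unfolds definitionally to maxList of `candidate`.
objective : ∀ n → Vec ℕ (suc n) → (r s : ℕ) → Vec ℕ (suc n) → Vec ℕ (suc r) → ℕ
objective n is r s ss u = (s ∸ V.sum u) * Drev n is (suc r) ss
  + sumFin r (λ k → lookup u (inject₁ k) * Drev n is (suc r ∸ suc (toℕ k)) ss)
  + last u * V.foldr _ _*_ 1 ss

candidate : ∀ n → Vec ℕ (suc n) → (r i s : ℕ) → Vec ℕ (suc n) → Vec ℕ (suc r) → ℕ
candidate n is r i s ss u =
  if (V.sum u ≤ᵇ s) ∧ (weight (suc r) u ≤ᵇ i) then objective n is r s ss u else 0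

objective-zero : ∀ n is r s ss → objective n is r s ss (V.replicate (suc r) 0) ≡ s * Drev n is (suc r) ss
objective-zero n is r s ss = begin
  (s ∸ V.sum (V.replicate r 0)) * Drev n is (suc r) ss
    + sumFin r (λ k → lookup (V.replicate (suc r) 0) (inject₁ k) * Drev n is (suc r ∸ suc (toℕ k)) ss)
    + last (V.replicate (suc r) 0) * V.foldr _ _*_ 1 ss
      ≡⟨ cong₂ _+_ (cong₂ _+_ (cong (λ z → (s ∸ z) * Drev n is (suc r) ss) (sum-replicate-zero r))
                              (sumFin-zero r (λ k → cong (_* Drev n is (suc r ∸ suc (toℕ k)) ss) (lookup-replicate (inject₁ k) 0))))
                   (cong (_* V.foldr _ _*_ 1 ss) (last-replicate r 0)) ⟩
  s * Drev n is (suc r) ss + 0 + 0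
      ≡⟨ trans (+-identityʳ _) (+-identityʳ _) ⟩
  s * Drev n is (suc r) ss ∎
  where open ≡-Reasoning

Drev-zeroDegree-∷ : ∀ n is r s ss → Drev (suc n) (0 ∷ is) (suc r) (s ∷ ss) ≡ s * Drev n is (suc r) ss
Drev-zeroDegree-∷ n is r s ss =
  maxList-attained (candidate n is r 0 s ss) (boundedVecs (suc r) s) candidate≤
    (boundedVecs-complete (suc r) s (V.replicate (suc r) 0) (λ k → subst (_≤ s) (sym (lookup-replicate k 0)) z≤n))
    (trans (if∧-true _ (≤⇒≤ᵇ (subst (_≤ s) (sym (sum-replicate-zero r)) z≤n))
                       (≤⇒≤ᵇ (≤-reflexive (weight-replicate-zero (suc r)))))
           (objective-zero n is r s ss))
  where
  candidate≤ : ∀ u → candidate n is r 0 s ss u ≤ s * Drev n is (suc r) ss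
  candidate≤ u = if∧-≤ (V.sum u ≤ᵇ s) (weight (suc r) u ≤ᵇ 0) λ _ weight≤0 →
    let u≡0 = sum≡0⇒replicate (suc r) u (n≤0⇒n≡0 (≤-trans (sum≤weight r u) (≤ᵇ⇒≤ _ 0 weight≤0)))
    in ≤-reflexive (trans (cong (objective n is r s ss) u≡0) (objective-zero n is r s ss))

lastOnly : ∀ r → ℕ → Vec ℕ (suc r)
lastOnly zero    q = q ∷ []
lastOnly (suc r) q = 0 ∷ lastOnly r q

sum-lastOnly : ∀ r q → V.sum (lastOnly r q) ≡ q
sum-lastOnly zero    q = +-identityʳ q
sum-lastOnly (suc r) q = sum-lastOnly r q

last-lastOnly : ∀ r q → last (lastOnly r q) ≡ q
last-lastOnly zero          q = refl
last-lastOnly (suc zero)    q = refl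
last-lastOnly (suc (suc r)) q = last-lastOnly (suc r) q

weight-lastOnly : ∀ r q → weight (suc r) (lastOnly r q) ≡ suc r * q
weight-lastOnly zero    q = +-identityʳ (1 * q)
weight-lastOnly (suc r) q = trans (weight-∷ (suc r) 0 (lastOnly r q)) (cong₂ _+_ (sum-lastOnly r q) (weight-lastOnly r q))

lookup-lastOnly≤ : ∀ r q k → lookup (lastOnly r q) k ≤ q
lookup-lastOnly≤ zero    q zero    = ≤-refl
lookup-lastOnly≤ (suc r) q zero    = z≤n
lookup-lastOnly≤ (suc r) q (suc k) = lookup-lastOnly≤ r q k

-- Below a variable of degree 0 every D vanishes, so only the term u_r s' remains.
objective-zeroDegree : ∀ r s s' u → objective 0 (0 ∷ []) r s (s' ∷ []) u ≡ last u * s'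
objective-zeroDegree r s s' u =
  cong₂ _+_ (cong₂ _+_ (*-zeroʳ (s ∸ V.sum u))
                       (sumFin-zero r (λ k → trans (cong (lookup u (inject₁ k) *_) (Drev-zeroDegree (r ∸ toℕ k)))
                                                   (*-zeroʳ (lookup u (inject₁ k))))))
            (cong (last u *_) (*-identityʳ s'))
  where
  Drev-zeroDegree : ∀ x → Drev 0 (0 ∷ []) x (s' ∷ []) ≡ 0
  Drev-zeroDegree zero    = refl
  Drev-zeroDegree (suc x) = refl

Drev-∷-zeroDegree : ∀ i r s s' → Drev 1 (i ∷ 0 ∷ []) (suc r) (s ∷ s' ∷ []) ≡ s' * (i / suc r ⊓ s)
Drev-∷-zeroDegree i r s s' =
  maxList-attained (candidate 0 (0 ∷ []) r i s (s' ∷ [])) (boundedVecs (suc r) s) candidate≤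
    (boundedVecs-complete (suc r) s (lastOnly r q) (λ k → ≤-trans (lookup-lastOnly≤ r q k) (m⊓n≤n _ s)))
    (trans (if∧-true _ (≤⇒≤ᵇ (subst (_≤ s) (sym (sum-lastOnly r q)) (m⊓n≤n _ s)))
                       (≤⇒≤ᵇ (subst (_≤ i) (sym (weight-lastOnly r q)) r*q≤i)))
           (trans (objective-zeroDegree r s s' (lastOnly r q))
                  (trans (cong (_* s') (last-lastOnly r q)) (*-comm q s'))))
  where
  q = i / suc r ⊓ s

  r*q≤i : suc r * q ≤ i
  r*q≤i = ≤-trans (*-monoʳ-≤ (suc r) (m⊓n≤m _ s))
                  (subst (_≤ i) (*-comm (i / suc r) (suc r)) (m/n*n≤m i (suc r)))

  last≤i/r : ∀ u → weight (suc r) u ≤ i → last u ≤ i / suc r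
  last≤i/r u weight≤i = subst (_≤ i / suc r) (m*n/n≡m (last u) (suc r))
    (/-monoˡ-≤ (suc r) (subst (_≤ i) (*-comm (suc r) (last u)) (≤-trans (*-last≤weight r u) weight≤i)))

  candidate≤ : ∀ u → candidate 0 (0 ∷ []) r i s (s' ∷ []) u ≤ s' * q
  candidate≤ u = if∧-≤ (V.sum u ≤ᵇ s) (weight (suc r) u ≤ᵇ i) λ sum≤s weight≤i →
    subst (_≤ s' * q) (sym (trans (objective-zeroDegree r s s' u) (*-comm (last u) s')))
      (*-monoʳ-≤ s' (⊓-glb (last≤i/r u (≤ᵇ⇒≤ _ _ weight≤i)) (≤-trans (last≤sum r u) (≤ᵇ⇒≤ _ _ sum≤s))))

module _ {n} (is ss : Vec ℕ (suc n)) (t : Fin (suc (suc n))) (s' : ℕ)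
  (scaled : ∀ r → Drev (suc n) (insertAt is t 0) r (insertAt ss t s') ≡ s' * Drev n is r ss) where

  objective-scaled : ∀ r s u → objective (suc n) (insertAt is t 0) r s (insertAt ss t s') u ≡ s' * objective n is r s ss u
  objective-scaled r s u = trans
    (cong₂ _+_ (cong₂ _+_ (cong ((s ∸ V.sum u) *_) (scaled (suc r)))
                          (trans (sumFin-cong r (λ k → trans (cong (lookup u (inject₁ k) *_) (scaled (r ∸ toℕ k)))
                                                             (*-left-comm (lookup u (inject₁ k)) s' _)))
                                 (sumFin-*ˡ r s' _)))
               (cong (last u *_) (product-insertAt ss t s')))
    (factor-out (s ∸ V.sum u) s' _ _ (last u) _)
    where
    *-left-comm : ∀ a b c → a * (b * c) ≡ b * (a * c)
    *-left-comm = solve-∀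
    factor-out : ∀ a c b x l p → a * (c * b) + c * x + l * (c * p) ≡ c * (a * b + x + l * p)
    factor-out = solve-∀

  Drev-∷-scaled : ∀ r i s → Drev (suc (suc n)) (i ∷ insertAt is t 0) (suc r) (s ∷ insertAt ss t s')
                          ≡ s' * Drev (suc n) (i ∷ is) (suc r) (s ∷ ss)
  Drev-∷-scaled r i s = maxList-scale _ _ s' (boundedVecs (suc r) s) (λ u → if-*ˡ _ s' (objective-scaled r s u))

Drev-insertAt-zeroDegree : ∀ n (is ss : Vec ℕ (suc n)) r t s' →
  Drev (suc n) (insertAt is t 0) r (insertAt ss t s') ≡ s' * Drev n is r ss
Drev-insertAt-zeroDegree n       is       ss       zero    t        s' = sym (*-zeroʳ s')
Drev-insertAt-zeroDegree n       is       ss       (suc r) zero     s' = Drev-zeroDegree-∷ n is r s' ss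
Drev-insertAt-zeroDegree zero    (i ∷ []) (s ∷ []) (suc r) (suc zero) s' = Drev-∷-zeroDegree i r s s'
Drev-insertAt-zeroDegree (suc n) (i ∷ is) (s ∷ ss) (suc r) (suc t) s' =
  Drev-∷-scaled is ss t s' (λ r → Drev-insertAt-zeroDegree n is ss r t s') r i s

D-insertAt-zeroDegree : ∀ {m} (i ss : Vec ℕ (suc m)) r t s' → D (insertAt i t 0) r (insertAt ss t s') ≡ s' * D i r ss
D-insertAt-zeroDegree {m} i ss r t s' rewrite reverse-insertAt i t 0 | reverse-insertAt ss t s' =
  Drev-insertAt-zeroDegree m (reverse i) (reverse ss) r (opposite t) s'

module _ {c ℓ} (F : Field c ℓ) where
  open Field F using (Carrier; _≈_; 0#; 1#)
    renaming (_+_ to _⊕_; _*_ to _⊗_; refl to ≈-refl; sym to ≈-sym; trans to ≈-trans;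
              +-cong to ⊕-cong; *-cong to ⊗-cong; +-identityʳ to ⊕-identityʳ; +-identityˡ to ⊕-identityˡ;
              *-identityˡ to ⊗-identityˡ; zeroˡ to ⊗-zeroˡ; zeroʳ to ⊗-zeroʳ)

  insertRoots : ∀ {n} (i : Vec ℕ n) t → Roots F n i → Roots F (suc n) (insertAt i t 0)
  insertRoots i       zero    R zero    = []
  insertRoots i       zero    R (suc u) = R u
  insertRoots (_ ∷ i) (suc t) R zero    = R zero
  insertRoots (_ ∷ i) (suc t) R (suc u) = insertRoots i t (λ u → R (suc u)) u

  removeRoots : ∀ {n} (i : Vec ℕ n) t → Roots F (suc n) (insertAt i t 0) → Roots F n i
  removeRoots i       zero    R u       = R (suc u)
  removeRoots (_ ∷ i) (suc t) R zero    = R zero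
  removeRoots (_ ∷ i) (suc t) R (suc u) = removeRoots i t (λ u → R (suc u)) u

  removeRoots-insertRoots : ∀ {n} (i : Vec ℕ n) t R u → removeRoots i t (insertRoots i t R) u ≡ R u
  removeRoots-insertRoots i       zero    R u       = refl
  removeRoots-insertRoots (_ ∷ i) (suc t) R zero    = refl
  removeRoots-insertRoots (_ ∷ i) (suc t) R (suc u) = removeRoots-insertRoots i t (λ u → R (suc u)) u

  roots-inserted≡[] : ∀ {n} (i : Vec ℕ n) t (R : Roots F (suc n) (insertAt i t 0)) → toList (R t) ≡ []
  roots-inserted≡[] i       zero    R with R zero
  ... | [] = refl
  roots-inserted≡[] (_ ∷ i) (suc t) R = roots-inserted≡[] i t (λ u → R (suc u))

  roots-punchIn : ∀ {n} (i : Vec ℕ n) t (R : Roots F (suc n) (insertAt i t 0)) u →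
    toList (R (punchIn t u)) ≡ toList (removeRoots i t R u)
  roots-punchIn i       zero    R u       = refl
  roots-punchIn (_ ∷ i) (suc t) R zero    = refl
  roots-punchIn (_ ∷ i) (suc t) R (suc u) = roots-punchIn i t (λ u → R (suc u)) u

  expand-cong : ∀ {n} (i : Vec ℕ n) {R R₁ : Roots F n i} → (∀ u → R u ≡ R₁ u) → expand F i R ≡ expand F i R₁
  expand-cong {n} i R≡R₁ = cong (L.foldr (mulLin F) ((1# , V.replicate n 0) ∷ []))
    (cong L.concat (map-cong (λ u → cong (λ v → L.map (u ,_) (toList v)) (R≡R₁ u)) (allFin n)))

  hasseMono-insertAt : ∀ {n} (e k : Vec ℕ n) (a : Vec Carrier n) t y →
    hasseMono F (insertAt e t 0) (insertAt k t 0) (insertAt a t y) ≈ hasseMono F e k a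
  hasseMono-insertAt e       k       a       zero    y = ≈-trans (⊗-cong (⊕-identityʳ 1#) ≈-refl) (⊗-identityˡ _)
  hasseMono-insertAt (_ ∷ e) (_ ∷ k) (_ ∷ a) (suc t) y = ⊗-cong ≈-refl (hasseMono-insertAt e k a t y)

  -- A derivative of positive order in a variable of exponent 0 carries the factor C(0, p+1) = 0.
  hasseMono-insertAt-vanishes : ∀ {n} (e : Vec ℕ n) (k : Vec ℕ (suc n)) (a : Vec Carrier (suc n)) t {p} →
    lookup k t ≡ suc p → hasseMono F (insertAt e t 0) k a ≈ 0#
  hasseMono-insertAt-vanishes e       (_ ∷ k) (_ ∷ a) zero    refl = ⊗-zeroˡ _
  hasseMono-insertAt-vanishes (_ ∷ e) (_ ∷ k) (_ ∷ a) (suc t) kt≡ =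
    ≈-trans (⊗-cong ≈-refl (hasseMono-insertAt-vanishes e k a t kt≡)) (⊗-zeroʳ _)

  module Lift {n} (t : Fin (suc n)) where

    liftFactor : Fin n × Carrier → Fin (suc n) × Carrier
    liftFactor (u , β) = punchIn t u , β

    liftTerm : Term F n → Term F (suc n)
    liftTerm (b , e) = b , insertAt e t 0

    factors-insertAt : (i : Vec ℕ n) (R : Roots F (suc n) (insertAt i t 0)) →
      factors F (insertAt i t 0) R ≡ L.map liftFactor (factors F i (removeRoots i t R))
    factors-insertAt i R = begin
      L.concat (L.map G (allFin (suc n)))                       ≡⟨ cong L.concat (map-tabulate (λ u → u) G) ⟩
      L.concat (L.tabulate G)                                   ≡⟨ concat-tabulate-punchIn G t (cong (L.map (t ,_)) (roots-inserted≡[] i t R)) ⟩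
      L.concat (L.tabulate (λ u → G (punchIn t u)))            ≡⟨ cong L.concat (L-tabulate-cong G-punchIn) ⟩
      L.concat (L.tabulate (λ u → L.map liftFactor (G₀ u)))    ≡⟨ cong L.concat (map-tabulate (λ u → u) (λ u → L.map liftFactor (G₀ u))) ⟨
      L.concat (L.map (L.map liftFactor ∘ G₀) (allFin n))      ≡⟨ cong L.concat (map-∘ (allFin n)) ⟩
      L.concat (L.map (L.map liftFactor) (L.map G₀ (allFin n))) ≡⟨ concat-map (L.map G₀ (allFin n)) ⟩
      L.map liftFactor (L.concat (L.map G₀ (allFin n)))        ∎
      where
      open ≡-Reasoning
      G : Fin (suc n) → List (Fin (suc n) × Carrier)
      G u = L.map (u ,_) (toList (R u))
      G₀ : Fin n → List (Fin n × Carrier)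
      G₀ u = L.map (u ,_) (toList (removeRoots i t R u))
      G-punchIn : ∀ u → G (punchIn t u) ≡ L.map liftFactor (G₀ u)
      G-punchIn u = trans (cong (L.map (punchIn t u ,_)) (roots-punchIn i t R u)) (map-∘ (toList (removeRoots i t R u)))

    mulLin-lift : ∀ u β ts → mulLin F (punchIn t u , β) (L.map liftTerm ts) ≡ L.map liftTerm (mulLin F (u , β) ts)
    mulLin-lift u β []             = refl
    mulLin-lift u β ((b , e) ∷ ts) =
      cong₂ _∷_ (cong (b ,_) (updateAt-insertAt-punchIn e t 0 u suc)) (cong (_ ∷_) (mulLin-lift u β ts))

    foldr-mulLin-lift : ∀ fs ts →
      L.foldr (mulLin F) (L.map liftTerm ts) (L.map liftFactor fs) ≡ L.map liftTerm (L.foldr (mulLin F) ts fs)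
    foldr-mulLin-lift []             ts = refl
    foldr-mulLin-lift ((u , β) ∷ fs) ts =
      trans (cong (mulLin F (punchIn t u , β)) (foldr-mulLin-lift fs ts)) (mulLin-lift u β (L.foldr (mulLin F) ts fs))

    expand-insertAt : (i : Vec ℕ n) (R : Roots F (suc n) (insertAt i t 0)) →
      expand F (insertAt i t 0) R ≡ L.map liftTerm (expand F i (removeRoots i t R))
    expand-insertAt i R =
      trans (cong₂ (L.foldr (mulLin F)) (cong (λ z → (1# , z) ∷ []) (sym (insertAt-replicate 0 t))) (factors-insertAt i R))
            (foldr-mulLin-lift (factors F i (removeRoots i t R)) ((1# , V.replicate n 0) ∷ []))

    hasseAt-lift : ∀ ts k a y → hasseAt F (L.map liftTerm ts) (insertAt k t 0) (insertAt a t y) ≈ hasseAt F ts k a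
    hasseAt-lift []             k a y = ≈-refl
    hasseAt-lift ((b , e) ∷ ts) k a y = ⊕-cong (⊗-cong ≈-refl (hasseMono-insertAt e k a t y)) (hasseAt-lift ts k a y)

    hasseAt-lift-vanishes : ∀ ts k a {p} → lookup k t ≡ suc p → hasseAt F (L.map liftTerm ts) k a ≈ 0#
    hasseAt-lift-vanishes []             k a kt≡ = ≈-refl
    hasseAt-lift-vanishes ((b , e) ∷ ts) k a kt≡ =
      ≈-trans (⊕-cong (≈-trans (⊗-cong ≈-refl (hasseMono-insertAt-vanishes e k a t kt≡)) (⊗-zeroʳ b))
                      (hasseAt-lift-vanishes ts k a kt≡))
              (⊕-identityˡ 0#)

    MultAtLeast-lift⁺ : ∀ P r a y → MultAtLeast F P r a → MultAtLeast F (L.map liftTerm P) r (insertAt a t y)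
    MultAtLeast-lift⁺ P r a y mult k Σk<r with lookup k t in kt≡
    ... | suc p = hasseAt-lift-vanishes P k (insertAt a t y) kt≡
    ... | zero  = subst (λ κ → hasseAt F (L.map liftTerm P) κ (insertAt a t y) ≈ 0#) k₀-insertAt
                        (≈-trans (hasseAt-lift P k₀ a y) (mult k₀ Σk₀<r))
      where
      k₀ = removeAt k t
      k₀-insertAt : insertAt k₀ t 0 ≡ k
      k₀-insertAt = trans (cong (insertAt k₀ t) (sym kt≡)) (insertAt-removeAt k t)
      Σk₀<r : V.sum k₀ < r
      Σk₀<r = subst (_< r) (trans (cong V.sum (sym k₀-insertAt)) (sum-insertAt k₀ t 0)) Σk<r

    MultAtLeast-lift⁻ : ∀ P r a y → MultAtLeast F (L.map liftTerm P) r (insertAt a t y) → MultAtLeast F P r a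
    MultAtLeast-lift⁻ P r a y mult k Σk<r =
      ≈-trans (≈-sym (hasseAt-lift P k a y)) (mult (insertAt k t 0) (subst (_< r) (sym (sum-insertAt k t 0)) Σk<r))

    DistinctPt-insertAt-≈ : ∀ a b {y y₁} → y ≈ y₁ → DistinctPt F a b → DistinctPt F (insertAt a t y) (insertAt b t y₁)
    DistinctPt-insertAt-≈ a b y≈y₁ a≠b a~b = a≠b (proj₂ (Pointwise-insertAt⁻ _≈_ t a~b))

    DistinctPt-insertAt-≉ : ∀ a b {y y₁} → ¬ (y ≈ y₁) → DistinctPt F (insertAt a t y) (insertAt b t y₁)
    DistinctPt-insertAt-≉ a b y≉y₁ a~b = y≉y₁ (proj₁ (Pointwise-insertAt⁻ _≈_ t a~b))

    DistinctPt-insertAt⁻ : ∀ a b {y y₁} → y ≈ y₁ → DistinctPt F (insertAt a t y) (insertAt b t y₁) → DistinctPt F a b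
    DistinctPt-insertAt⁻ a b y≈y₁ a≠b a~b = a≠b (Pointwise-insertAt⁺ _≈_ t y≈y₁ a~b)

  _∈≈_ : Carrier → List Carrier → Set (c Level.⊔ ℓ)
  y ∈≈ S = Any (y ≈_) S

  ∈≈-self : ∀ S → All (_∈≈ S) S
  ∈≈-self []      = []
  ∈≈-self (y ∷ S) = here ≈-refl ∷ All.map there (∈≈-self S)

  GridPoint : ∀ {n} → Vec (List Carrier) n → List (Term F n) → ℕ → Vec Carrier n → Set (c Level.⊔ ℓ)
  GridPoint Ts P r a = InBox F Ts a × MultAtLeast F P r a

  module Grid {n} (Ss : Vec (List Carrier) n) (t : Fin (suc n)) (P : List (Term F n)) (r : ℕ) where
    open Lift t

    Base : Vec Carrier n → Set (c Level.⊔ ℓ)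
    Base = GridPoint Ss P r

    Lifted : List Carrier → Vec Carrier (suc n) → Set (c Level.⊔ ℓ)
    Lifted S = GridPoint (insertAt Ss t S) (L.map liftTerm P) r

    lifted⁺ : ∀ {S a y} → y ∈≈ S → Base a → Lifted S (insertAt a t y)
    lifted⁺ y∈S (inBox , mult) = Pointwise-insertAt⁺ _∈≈_ t y∈S inBox , MultAtLeast-lift⁺ P r _ _ mult

    lifted-insertAt⁻ : ∀ {S} a y → Lifted S (insertAt a t y) → y ∈≈ S × Base a
    lifted-insertAt⁻ a y (inBox , mult) with Pointwise-insertAt⁻ _∈≈_ {xs = a} {Ss} t inBox
    ... | y∈S , inBox₀ = y∈S , inBox₀ , MultAtLeast-lift⁻ P r a y mult

    lifted⁻ : ∀ {S} a → Lifted S a → lookup a t ∈≈ S × Base (removeAt a t)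
    lifted⁻ {S} a = lifted-insertAt⁻ (removeAt a t) (lookup a t) ∘ subst (Lifted S) (sym (insertAt-removeAt a t))

    lifted-∷ : ∀ {z S} a → Lifted (z ∷ S) a → (lookup a t ≈ z × Base (removeAt a t)) ⊎ Lifted S a
    lifted-∷ {S = S} a lifted with lifted⁻ a lifted
    ... | here at≈z  , base = inj₁ (at≈z , base)
    ... | there at∈S , base = inj₂ (subst (Lifted S) (insertAt-removeAt a t) (lifted⁺ at∈S base))

    -- Split the points by their new coordinate: those equal to the head z of S
    -- project to distinct base points, the others are counted by induction.
    length≤ : ∀ {v} → (∀ h → AtLeastPoints F Ss P r h → h ≤ v) →
      ∀ S pts → All (Lifted S) pts → AllPairs (DistinctPt F) pts → length pts ≤ length S * v
    length≤ bound []      []      _              _ = z≤n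
    length≤ bound []      (a ∷ _) (lifted ∷ _)   _ with lifted⁻ a lifted
    ... | () , _
    length≤ {v} bound (z ∷ S) pts lifted distinct with partition-⊎ (All.map (λ {a} → lifted-∷ a) lifted)
    ... | layer , rest , layer⊆ , rest⊆ , onLayer , restLifted , len =
      subst (_≤ length (z ∷ S) * v) len
        (+-mono-≤ layer≤v (length≤ bound S rest restLifted (AllPairs-resp-⊆ rest⊆ distinct)))
      where
      OnLayer : Vec Carrier (suc n) → Set (c Level.⊔ ℓ)
      OnLayer a = lookup a t ≈ z × Base (removeAt a t)

      removeAt-distinct : ∀ {a b} → OnLayer a → OnLayer b → DistinctPt F a b → DistinctPt F (removeAt a t) (removeAt b t)
      removeAt-distinct {a} {b} (at≈z , _) (bt≈z , _) a≠b =
        DistinctPt-insertAt⁻ (removeAt a t) (removeAt b t) (≈-trans at≈z (≈-sym bt≈z))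
          (subst₂ (DistinctPt F) (sym (insertAt-removeAt a t)) (sym (insertAt-removeAt b t)) a≠b)

      layer≤v : length layer ≤ v
      layer≤v = subst (_≤ v) (length-map (λ a → removeAt a t) layer)
        (bound _ (L.map (λ a → removeAt a t) layer , refl , All.map⁺ (All.map proj₂ onLayer) ,
                  AllPairs-map⁺-within (λ a → removeAt a t) (λ {a} {b} → removeAt-distinct {a} {b}) onLayer (AllPairs-resp-⊆ layer⊆ distinct)))

    liftedPoints : List Carrier → List (Vec Carrier n) → List (Vec Carrier (suc n))
    liftedPoints Ys pts = L.concatMap (λ y → L.map (λ a → insertAt a t y) pts) Ys

    length-liftedPoints : ∀ Ys pts → length (liftedPoints Ys pts) ≡ length Ys * length pts
    length-liftedPoints Ys pts = length-concatMap-const _ Ys (λ y → length-map _ pts)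

    liftedPoints-lifted : ∀ S Ys pts → All (_∈≈ S) Ys → All Base pts → All (Lifted S) (liftedPoints Ys pts)
    liftedPoints-lifted S []       pts []           bases = []
    liftedPoints-lifted S (y ∷ Ys) pts (y∈S ∷ Ys∈S) bases =
      All.++⁺ (All.map⁺ (All.map (lifted⁺ y∈S) bases)) (liftedPoints-lifted S Ys pts Ys∈S bases)

    liftedPoints-distinct : ∀ Ys pts → AllPairs (λ x y → ¬ (x ≈ y)) Ys → AllPairs (DistinctPt F) pts →
      AllPairs (DistinctPt F) (liftedPoints Ys pts)
    liftedPoints-distinct []       pts []             distinct = []
    liftedPoints-distinct (y ∷ Ys) pts (y≉Ys ∷ Ys≉) distinct =
      AllPairs.++⁺ (AllPairs.map⁺ (AllPairs.map (λ {a} {b} → DistinctPt-insertAt-≈ a b ≈-refl) distinct))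
                   (liftedPoints-distinct Ys pts Ys≉ distinct)
                   (All.map⁺ (All.universal (λ a → across a Ys y≉Ys) pts))
      where
      across : ∀ a Zs → All (λ z → ¬ (y ≈ z)) Zs → All (DistinctPt F (insertAt a t y)) (liftedPoints Zs pts)
      across a []       []           = []
      across a (z ∷ Zs) (y≉z ∷ y≉Zs) =
        All.++⁺ (All.map⁺ (All.universal (λ b → DistinctPt-insertAt-≉ a b y≉z) pts)) (across a Zs y≉Zs)

  AtLeastPoints-insertAt-bounded : ∀ {n} (Ss : Vec (List Carrier) n) t (i : Vec ℕ n) r {v} S →
    (∀ R h → AtLeastPoints F Ss (expand F i R) r h → h ≤ v) →
    ∀ R h → AtLeastPoints F (insertAt Ss t S) (expand F (insertAt i t 0) R) r h → h ≤ length S * v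
  AtLeastPoints-insertAt-bounded Ss t i r S bound R h (pts , len , lifted , distinct) =
    subst (_≤ length S * _) len (Grid.length≤ Ss t P r (bound R₀) S pts lifted₀ distinct)
    where
    R₀ = removeRoots i t R
    P = expand F i R₀
    lifted₀ : All (Grid.Lifted Ss t P r S) pts
    lifted₀ = subst (λ Q → All (GridPoint (insertAt Ss t S) Q r) pts) (Lift.expand-insertAt t i R) lifted

  AtLeastPoints-insertAt-attained : ∀ {n} (Ss : Vec (List Carrier) n) t (i : Vec ℕ n) r {v} S → IsFinSet F S →
    (Σ (Roots F n i) λ R → AtLeastPoints F Ss (expand F i R) r v) →
    Σ (Roots F (suc n) (insertAt i t 0)) λ R → AtLeastPoints F (insertAt Ss t S) (expand F (insertAt i t 0) R) r (length S * v)
  AtLeastPoints-insertAt-attained Ss t i r {v} S S-distinct (R₀ , pts , len , bases , distinct) =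
    insertRoots i t R₀ ,
    subst (λ Q → AtLeastPoints F (insertAt Ss t S) Q r (length S * v)) (sym expand≡)
      (liftedPoints S pts , trans (length-liftedPoints S pts) (cong (length S *_) len) ,
       liftedPoints-lifted S S pts (∈≈-self S) bases , liftedPoints-distinct S pts S-distinct distinct)
    where
    open Grid Ss t (expand F i R₀) r
    expand≡ : expand F (insertAt i t 0) (insertRoots i t R₀) ≡ L.map (Lift.liftTerm t) (expand F i R₀)
    expand≡ = trans (Lift.expand-insertAt t i (insertRoots i t R₀))
                    (cong (L.map (Lift.liftTerm t)) (expand-cong i (removeRoots-insertRoots i t R₀)))

proposition38 : ∀ {c ℓ} (F : Field c ℓ) (m : ℕ)
    (Ss : Vec (List (Field.Carrier F)) (suc m)) (S' : List (Field.Carrier F))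
    → (∀ j → IsFinSet F (lookup Ss j)) → IsFinSet F S'
    → (r : ℕ) → 1 ≤ r → (i : Vec ℕ (suc m))
    → IsH F Ss i r (D i r (map length Ss))
    → (t : Fin (suc (suc m)))
    → IsH F (insertAt Ss t S') (insertAt i t 0) r (D (insertAt i t 0) r (map length (insertAt Ss t S')))
    × D (insertAt i t 0) r (map length (insertAt Ss t S')) ≡ length S' * D i r (map length Ss)
proposition38 F m Ss S' _ S'-distinct r _ i (attained , bounded) t =
  subst (IsH F (insertAt Ss t S') (insertAt i t 0) r) (sym D≡)
    ( AtLeastPoints-insertAt-attained F Ss t i r S' S'-distinct attained
    , AtLeastPoints-insertAt-bounded F Ss t i r S' bounded )
  , D≡
  where
  D≡ : D (insertAt i t 0) r (map length (insertAt Ss t S')) ≡ length S' * D i r (map length Ss)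
  D≡ = trans (cong (D (insertAt i t 0) r) (map-insertAt length S' Ss t))
             (D-insertAt-zeroDegree i (map length Ss) r t (length S'))
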